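{- Algorithm $\mathrm{cCHASE}$, which sets $x_0\leftarrow0$ and, for $t=1,\dots,T$, upon receiving $\sigma_t$ sets $x_t\leftarrow(\beta+\Delta(t))/\beta$, is $2$-competitive for problem cSP.
   Context: Fix a horizon $T\in\mathbb{N}$, a constant $\beta>0$ and a constant $H$. Each input $\sigma_t=(e_t,p^0_t,p^1_t,B_t)$ determines $g_t:\{0,1\}\to\mathbb{R}$ by $g_t(1)=e_t p^1_t$ and $g_t(0)=e_t p^0_t+(p^1_t-p^0_t)(e_t-1.1B_t)^+-H(0.9B_t-e_t)^+$, with $(x)^+=\max\{x,0\}$; these are taken to be nonnegative. Problem cSP: given $\boldsymbol{\sigma}=(\sigma_1,\dots,\sigma_T)$, minimize $\sum_{t=1}^T\big(g(\sigma_t,x_t)+\beta(x_t-x_{t-1})^+\big)$ over $x_t\in[0,1]$, with $x_0=0$, where $g(\sigma_t,x)=(g_t(1)-g_t(0))\,x+g_t(0)$ for $x\in[0,1]$. Define $\delta(t)=g_t(0)-g_t(1)$, $\Delta(0)=-\beta$, $\Delta(t)=\min\{0,\max\{\Delta(t-1)+\delta(t),-\beta\}\}$ for $t\ge1$. An online algorithm chooses $x_t$ based only on $\sigma_1,\dots,\sigma_t$; it is $c$-competitive if there is a constant $\gamma$ depending only on the initial state such that its cost is at most $c$ times the offline optimal value of cSP plus $\gamma$, for every input sequence $\boldsymbol{\sigma}$.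
   Formalization: The constants β and H, the entries of each input $\sigma_t=(e_t,p^0_t,p^1_t,B_t)$, and the offline decisions x_t ∈ [0,1] that cCHASE is compared against are all rational. -}

module Defs where

open import Data.Nat using (ℕ; zero; suc)
open import Data.Integer using (+_)
open import Data.Rational using (ℚ; 0ℚ; 1ℚ; _+_; _-_; _*_; _÷_; _/_; _⊔_; _⊓_; -_; _≤_; _>_; >-nonZero)
open import Data.Vec using (Vec; []; _∷_)
open import Data.Product using (_×_)
open import Data.Unit using (⊤)

pos : ℚ → ℚ
pos x = x ⊔ 0ℚ

record Input : Set where
  constructor input
  field
    e  : ℚ
    p0 : ℚ
    p1 : ℚ
    B  : ℚ
open Input public

g1 : Input → ℚ
g1 s = e s * p1 s

g0 : (H : ℚ) → Input → ℚ
g0 H s = e s * p0 s + (p1 s - p0 s) * pos (e s - (+ 11 / 10) * B s)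
         - H * pos ((+ 9 / 10) * B s - e s)

g : (H : ℚ) → Input → ℚ → ℚ
g H s x = (g1 s - g0 H s) * x + g0 H s

δ : (H : ℚ) → Input → ℚ
δ H s = g0 H s - g1 s

costFrom : (β H : ℚ) → (prev : ℚ) → {n : ℕ} → Vec Input n → Vec ℚ n → ℚ
costFrom β H prev []       []       = 0ℚ
costFrom β H prev (s ∷ ss) (x ∷ xs) =
  g H s x + β * pos (x - prev) + costFrom β H x ss xs

cost : (β H : ℚ) → {n : ℕ} → Vec Input n → Vec ℚ n → ℚ
cost β H σ x = costFrom β H 0ℚ σ x

Δstep : (β H : ℚ) → ℚ → Input → ℚ
Δstep β H Δprev s = 0ℚ ⊓ ((Δprev + δ H s) ⊔ (- β))

ΔsFrom : (β H : ℚ) → ℚ → {n : ℕ} → Vec Input n → Vec ℚ n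
ΔsFrom β H Δprev []       = []
ΔsFrom β H Δprev (s ∷ ss) = Δstep β H Δprev s ∷ ΔsFrom β H (Δstep β H Δprev s) ss

cCHASE : (β H : ℚ) → (β>0 : β > 0ℚ) → {n : ℕ} → Vec Input n → Vec ℚ n
cCHASE β H β>0 σ = go (ΔsFrom β H (- β) σ)
  where
  go : {n : ℕ} → Vec ℚ n → Vec ℚ n
  go []       = []
  go (d ∷ ds) = ((β + d) ÷ β) {{>-nonZero β>0}} ∷ go ds

data InUnit : {n : ℕ} → Vec ℚ n → Set where
  []  : InUnit []
  _∷_ : ∀ {n x} {xs : Vec ℚ n} → 0ℚ ≤ x × x ≤ 1ℚ → InUnit xs → InUnit (x ∷ xs)

NonNegInputs : (H : ℚ) → {n : ℕ} → Vec Input n → Set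
NonNegInputs H []       = ⊤
NonNegInputs H (s ∷ ss) = (0ℚ ≤ g0 H s) × (0ℚ ≤ g1 s) × NonNegInputs H ss

{-# OPTIONS --safe #-}
-- Write x for the online and y for the offline state and use the potential
-- Φ(x, y) = β x²/2 + 2β y (1 - x), which vanishes at (0, 0) and is nonnegative on [0,1]².
-- Since ∂Φ/∂y = 2β (1 - x) ∈ [0, 2β], an offline move y ↦ y′ raises Φ by at most 2β (y′ - y)⁺.
-- The online move x ↦ x′ = clamp(x + δ/β) satisfies g(x′) + β (x′ - x)⁺ + Φ(x′, y′) ≤ 2 g(y′) + Φ(x, y′):
-- in each of its three cases the slack is an explicit sum of nonnegative terms.
-- Adding the two and telescoping over t gives cost(cCHASE) ≤ 2 cost(x) + Φ(0, 0) = 2 cost(x).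
module Submission where

open import Defs
open import Data.Nat using (ℕ; suc)
open import Data.Integer using (+_)
open import Data.Rational using (ℚ; 0ℚ; 1ℚ; ½; _+_; _-_; _*_; _÷_; _/_; 1/_; _⊔_; _⊓_; -_; _≤_; _>_; >-nonZero; positive; nonNegative)
open import Data.Rational.Properties
open import Data.Vec using (Vec; []; _∷_; tail; map)
open import Data.Product using (Σ; _,_; _×_; proj₁; proj₂)
open import Data.Sum using (inj₁; inj₂)
open import Relation.Nullary.Decidable using (dec⇒maybe)
open import Relation.Binary.PropositionalEquality
open import Tactic.RingSolver using (solve-∀)
open import Tactic.RingSolver.Core.AlmostCommutativeRing using (AlmostCommutativeRing; fromCommutativeRing)

ℚ-ring : AlmostCommutativeRing _ _
ℚ-ring = fromCommutativeRing +-*-commutativeRing (λ x → dec⇒maybe (0ℚ ≟ x))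

2ℚ : ℚ
2ℚ = + 2 / 1

_∈[0,1] : ℚ → Set
x ∈[0,1] = 0ℚ ≤ x × x ≤ 1ℚ

p≤q⇒0≤q-p : ∀ {p q} → p ≤ q → 0ℚ ≤ q - p
p≤q⇒0≤q-p {p} {q} p≤q = subst (_≤ q - p) (+-inverseʳ p) (+-monoˡ-≤ (- p) p≤q)

p≤q⇒p-q≤0 : ∀ {p q} → p ≤ q → p - q ≤ 0ℚ
p≤q⇒p-q≤0 {p} {q} p≤q = subst (p - q ≤_) (+-inverseʳ q) (+-monoˡ-≤ (- q) p≤q)

≤-byDifference : ∀ {p q} r → q - p ≡ r → 0ℚ ≤ r → p ≤ q
≤-byDifference {p} {q} r q-p≡r 0≤r = begin
  p            ≡⟨ sym (+-identityʳ p) ⟩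
  p + 0ℚ       ≤⟨ +-monoʳ-≤ p 0≤r ⟩
  p + r        ≡⟨ cong (_+_ p) (sym q-p≡r) ⟩
  p + (q - p)  ≡⟨ p+[q-p]≡q p q ⟩
  q            ∎
  where
  open ≤-Reasoning
  p+[q-p]≡q : ∀ p q → p + (q - p) ≡ q
  p+[q-p]≡q = solve-∀ ℚ-ring

0≤p*q : ∀ {p q} → 0ℚ ≤ p → 0ℚ ≤ q → 0ℚ ≤ p * q
0≤p*q {p} {q} 0≤p 0≤q = subst (_≤ p * q) (*-zeroˡ q) (*-monoʳ-≤-nonNeg q {{nonNegative 0≤q}} 0≤p)

0≤p*p : ∀ p → 0ℚ ≤ p * p
0≤p*p p with ≤-total 0ℚ p
... | inj₁ 0≤p = 0≤p*q 0≤p 0≤p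
... | inj₂ p≤0 = subst (0ℚ ≤_) (-p*-p≡p*p p) (0≤p*q 0≤-p 0≤-p)
  where
  0≤-p : 0ℚ ≤ - p
  0≤-p = neg-antimono-≤ p≤0
  -p*-p≡p*p : ∀ p → - p * - p ≡ p * p
  -p*-p≡p*p = solve-∀ ℚ-ring

0≤p*[q*q]*½ : ∀ {p} q → 0ℚ ≤ p → 0ℚ ≤ p * (q * q) * ½
0≤p*[q*q]*½ q 0≤p = 0≤p*q (0≤p*q 0≤p (0≤p*p q)) (nonNegative⁻¹ ½)

q≤p⇒pos[p-q]≡p-q : ∀ {p q} → q ≤ p → pos (p - q) ≡ p - q
q≤p⇒pos[p-q]≡p-q q≤p = p≥q⇒p⊔q≡p (p≤q⇒0≤q-p q≤p)

p≤q⇒pos[p-q]≡0 : ∀ {p q} → p ≤ q → pos (p - q) ≡ 0ℚ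
p≤q⇒pos[p-q]≡0 p≤q = p≤q⇒p⊔q≡q (p≤q⇒p-q≤0 p≤q)

-- lerp (g0 H s) (g1 s) is g H s. Both lerp and Φ are INLINE so that solve-∀ sees the polynomials behind them.
lerp : ℚ → ℚ → ℚ → ℚ
lerp a b z = (b - a) * z + a
{-# INLINE lerp #-}

Φ : ℚ → ℚ → ℚ → ℚ
Φ β x y = β * x * x * ½ + 2ℚ * β * y * (1ℚ - x)
{-# INLINE Φ #-}

0≤Φ : ∀ {β x y} → 0ℚ ≤ β → x ∈[0,1] → 0ℚ ≤ y → 0ℚ ≤ Φ β x y
0≤Φ 0≤β (0≤x , x≤1) 0≤y =
  +-mono-≤ (0≤p*q (0≤p*q (0≤p*q 0≤β 0≤x) 0≤x) (nonNegative⁻¹ ½))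
           (0≤p*q (0≤p*q (0≤p*q (nonNegative⁻¹ 2ℚ) 0≤β) 0≤y) (p≤q⇒0≤q-p x≤1))

Φ-origin : ∀ β → Φ β 0ℚ 0ℚ ≡ 0ℚ
Φ-origin = solve-∀ ℚ-ring

-- The three moves x ↦ x′ of the chase for costs a at 0 and b at 1: to x + (a - b)/β, or clamped at 1 or 0.
-- The interior equation is solved for a so that it can be matched on.
data Move (β a b x x′ : ℚ) : Set where
  interior : a ≡ b + β * (x′ - x) → Move β a b x x′
  toOne    : x′ ≡ 1ℚ → β * (1ℚ - x) ≤ a - b → Move β a b x x′
  toZero   : x′ ≡ 0ℚ → a - b + β * x ≤ 0ℚ → Move β a b x x′

online-move : ∀ {β a b x x′} y → 0ℚ ≤ β → 0ℚ ≤ a → 0ℚ ≤ b → x ∈[0,1] → y ∈[0,1] → Move β a b x x′ →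
  lerp a b x′ + β * pos (x′ - x) + Φ β x′ y ≤ 2ℚ * lerp a b y + Φ β x y
online-move {β} {b = b} {x} {x′} y 0≤β 0≤a 0≤b _ _ (interior refl) with ≤-total x x′
... | inj₁ x≤x′ rewrite q≤p⇒pos[p-q]≡p-q x≤x′ =
  ≤-byDifference _ (slack β b x x′ y) (+-mono-≤ 0≤b (0≤p*[q*q]*½ (x′ - x) 0≤β))
  where
  slack : ∀ β b x x′ y →
    2ℚ * lerp (b + β * (x′ - x)) b y + Φ β x y - (lerp (b + β * (x′ - x)) b x′ + β * (x′ - x) + Φ β x′ y)
    ≡ b + β * ((x′ - x) * (x′ - x)) * ½
  slack = solve-∀ ℚ-ring
... | inj₂ x′≤x rewrite p≤q⇒pos[p-q]≡0 x′≤x =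
  ≤-byDifference _ (slack β b x x′ y) (+-mono-≤ 0≤a (0≤p*[q*q]*½ (x′ - x) 0≤β))
  where
  slack : ∀ β b x x′ y →
    2ℚ * lerp (b + β * (x′ - x)) b y + Φ β x y - (lerp (b + β * (x′ - x)) b x′ + β * 0ℚ + Φ β x′ y)
    ≡ (b + β * (x′ - x)) + β * ((x′ - x) * (x′ - x)) * ½
  slack = solve-∀ ℚ-ring
online-move {β} {a} {b} {x} y 0≤β _ 0≤b (_ , x≤1) (_ , y≤1) (toOne refl β[1-x]≤a-b)
  rewrite q≤p⇒pos[p-q]≡p-q x≤1 =
  ≤-byDifference _ (slack β a b x y)
    (+-mono-≤ (+-mono-≤ 0≤b (0≤p*q (0≤p*q (nonNegative⁻¹ 2ℚ) (p≤q⇒0≤q-p β[1-x]≤a-b)) (p≤q⇒0≤q-p y≤1)))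
              (0≤p*[q*q]*½ (1ℚ - x) 0≤β))
  where
  slack : ∀ β a b x y →
    2ℚ * lerp a b y + Φ β x y - (lerp a b 1ℚ + β * (1ℚ - x) + Φ β 1ℚ y)
    ≡ b + 2ℚ * (a - b - β * (1ℚ - x)) * (1ℚ - y) + β * ((1ℚ - x) * (1ℚ - x)) * ½
  slack = solve-∀ ℚ-ring
online-move {β} {a} {b} {x} y 0≤β 0≤a _ (0≤x , _) (0≤y , _) (toZero refl a-b+βx≤0)
  rewrite p≤q⇒pos[p-q]≡0 0≤x =
  ≤-byDifference _ (slack β a b x y)
    (+-mono-≤ (+-mono-≤ 0≤a (0≤p*q (0≤p*q (nonNegative⁻¹ 2ℚ) 0≤y) (neg-antimono-≤ a-b+βx≤0)))
              (0≤p*[q*q]*½ x 0≤β))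
  where
  slack : ∀ β a b x y →
    2ℚ * lerp a b y + Φ β x y - (lerp a b 0ℚ + β * 0ℚ + Φ β 0ℚ y)
    ≡ a + 2ℚ * y * (- (a - b + β * x)) + β * (x * x) * ½
  slack = solve-∀ ℚ-ring

offline-move : ∀ {β x} y y′ → 0ℚ ≤ β → x ∈[0,1] → Φ β x y′ ≤ 2ℚ * β * pos (y′ - y) + Φ β x y
offline-move {β} {x} y y′ 0≤β (0≤x , x≤1) with ≤-total y y′
... | inj₁ y≤y′ rewrite q≤p⇒pos[p-q]≡p-q y≤y′ =
  ≤-byDifference _ (slack β x y y′) (0≤p*q (0≤p*q (0≤p*q (nonNegative⁻¹ 2ℚ) 0≤β) 0≤x) (p≤q⇒0≤q-p y≤y′))
  where
  slack : ∀ β x y y′ → 2ℚ * β * (y′ - y) + Φ β x y - Φ β x y′ ≡ 2ℚ * β * x * (y′ - y)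
  slack = solve-∀ ℚ-ring
... | inj₂ y′≤y rewrite p≤q⇒pos[p-q]≡0 y′≤y =
  ≤-byDifference _ (slack β x y y′) (0≤p*q (0≤p*q (0≤p*q (nonNegative⁻¹ 2ℚ) 0≤β) (p≤q⇒0≤q-p x≤1)) (p≤q⇒0≤q-p y′≤y))
  where
  slack : ∀ β x y y′ → 2ℚ * β * 0ℚ + Φ β x y - Φ β x y′ ≡ 2ℚ * β * (1ℚ - x) * (y - y′)
  slack = solve-∀ ℚ-ring

amortised-step : ∀ {β a b x x′} y y′ → 0ℚ ≤ β → 0ℚ ≤ a → 0ℚ ≤ b → x ∈[0,1] → y′ ∈[0,1] → Move β a b x x′ →
  lerp a b x′ + β * pos (x′ - x) + Φ β x′ y′ ≤ 2ℚ * (lerp a b y′ + β * pos (y′ - y)) + Φ β x y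
amortised-step {β} {a} {b} {x} {x′} y y′ 0≤β 0≤a 0≤b x∈ y′∈ move = begin
  lerp a b x′ + β * pos (x′ - x) + Φ β x′ y′           ≤⟨ online-move y′ 0≤β 0≤a 0≤b x∈ y′∈ move ⟩
  2ℚ * lerp a b y′ + Φ β x y′                          ≤⟨ +-monoʳ-≤ (2ℚ * lerp a b y′) (offline-move y y′ 0≤β x∈) ⟩
  2ℚ * lerp a b y′ + (2ℚ * β * pos (y′ - y) + Φ β x y) ≡⟨ regroup (lerp a b y′) β (pos (y′ - y)) (Φ β x y) ⟩
  2ℚ * (lerp a b y′ + β * pos (y′ - y)) + Φ β x y      ∎
  where
  open ≤-Reasoning
  regroup : ∀ u β v w → 2ℚ * u + (2ℚ * β * v + w) ≡ 2ℚ * (u + β * v) + w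
  regroup = solve-∀ ℚ-ring

lower-clamp : ∀ {β Δ δ x} → β * x ≡ β + Δ → Δ + δ ≤ - β → δ + β * x ≤ 0ℚ
lower-clamp {β} {Δ} {δ} βx≡β+Δ Δ+δ≤-β rewrite βx≡β+Δ =
  subst (_≤ 0ℚ) (rearrange β Δ δ) (p≤q⇒p-q≤0 Δ+δ≤-β)
  where
  rearrange : ∀ β Δ δ → Δ + δ - - β ≡ δ + (β + Δ)
  rearrange = solve-∀ ℚ-ring

interior-shift : ∀ {β Δ a b x x′} → β * x ≡ β + Δ → β * x′ ≡ β + (Δ + (a - b)) → a ≡ b + β * (x′ - x)
interior-shift {β} {Δ} {a} {b} {x} {x′} βx≡β+Δ βx′≡β+Δ′ = begin
  a                                    ≡⟨ rearrange β Δ a b ⟩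
  b + ((β + (Δ + (a - b))) - (β + Δ))  ≡⟨ cong₂ (λ u v → b + (u - v)) (sym βx′≡β+Δ′) (sym βx≡β+Δ) ⟩
  b + (β * x′ - β * x)                 ≡⟨ factor β b x x′ ⟩
  b + β * (x′ - x)                     ∎
  where
  open ≡-Reasoning
  rearrange : ∀ β Δ a b → a ≡ b + ((β + (Δ + (a - b))) - (β + Δ))
  rearrange = solve-∀ ℚ-ring
  factor : ∀ β b x x′ → b + (β * x′ - β * x) ≡ b + β * (x′ - x)
  factor = solve-∀ ℚ-ring

upper-clamp : ∀ {β Δ δ x} → β * x ≡ β + Δ → 0ℚ ≤ Δ + δ → β * (1ℚ - x) ≤ δ
upper-clamp {β} {Δ} {δ} {x} βx≡β+Δ 0≤Δ+δ = ≤-byDifference (Δ + δ) gap 0≤Δ+δ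
  where
  open ≡-Reasoning
  expand : ∀ β δ x → δ - β * (1ℚ - x) ≡ δ - β + β * x
  expand = solve-∀ ℚ-ring
  cancel : ∀ β Δ δ → δ - β + (β + Δ) ≡ Δ + δ
  cancel = solve-∀ ℚ-ring
  gap : δ - β * (1ℚ - x) ≡ Δ + δ
  gap = begin
    δ - β * (1ℚ - x)  ≡⟨ expand β δ x ⟩
    δ - β + β * x     ≡⟨ cong (_+_ (δ - β)) βx≡β+Δ ⟩
    δ - β + (β + Δ)   ≡⟨ cancel β Δ δ ⟩
    Δ + δ             ∎

module Chase (β H : ℚ) (β>0 : β > 0ℚ) where

  0≤β : 0ℚ ≤ β
  0≤β = <⇒≤ β>0

  -β≤0 : - β ≤ 0ℚ
  -β≤0 = neg-antimono-≤ 0≤β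

  β*-cancel-≤ : ∀ {p q} → β * p ≤ β * q → p ≤ q
  β*-cancel-≤ = *-cancelˡ-≤-pos β {{positive β>0}}

  state : ℚ → ℚ
  state Δ = ((β + Δ) ÷ β) {{>-nonZero β>0}}

  β*state : ∀ Δ → β * state Δ ≡ β + Δ
  β*state Δ = begin
    β * ((β + Δ) * β⁻¹)  ≡⟨ sym (*-assoc β (β + Δ) β⁻¹) ⟩
    β * (β + Δ) * β⁻¹    ≡⟨ cong (_* β⁻¹) (*-comm β (β + Δ)) ⟩
    (β + Δ) * β * β⁻¹    ≡⟨ *-assoc (β + Δ) β β⁻¹ ⟩
    (β + Δ) * (β * β⁻¹)  ≡⟨ cong (_*_ (β + Δ)) (*-inverseʳ β {{>-nonZero β>0}}) ⟩
    (β + Δ) * 1ℚ         ≡⟨ *-identityʳ (β + Δ) ⟩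
    β + Δ                ∎
    where
    open ≡-Reasoning
    β⁻¹ : ℚ
    β⁻¹ = (1/ β) {{>-nonZero β>0}}

  state-∈[0,1] : ∀ {Δ} → - β ≤ Δ → Δ ≤ 0ℚ → state Δ ∈[0,1]
  state-∈[0,1] {Δ} -β≤Δ Δ≤0 = β*-cancel-≤ lower , β*-cancel-≤ upper
    where
    open ≤-Reasoning
    lower : β * 0ℚ ≤ β * state Δ
    lower = begin
      β * 0ℚ     ≡⟨ *-zeroʳ β ⟩
      0ℚ         ≡⟨ sym (+-inverseʳ β) ⟩
      β - β      ≤⟨ +-monoʳ-≤ β -β≤Δ ⟩
      β + Δ      ≡⟨ sym (β*state Δ) ⟩
      β * state Δ ∎
    upper : β * state Δ ≤ β * 1ℚ
    upper = begin
      β * state Δ ≡⟨ β*state Δ ⟩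
      β + Δ      ≤⟨ +-monoʳ-≤ β Δ≤0 ⟩
      β + 0ℚ     ≡⟨ +-identityʳ β ⟩
      β          ≡⟨ sym (*-identityʳ β) ⟩
      β * 1ℚ     ∎

  β*-injective : ∀ {p q} → β * p ≡ β * q → p ≡ q
  β*-injective βp≡βq = ≤-antisym (β*-cancel-≤ (≤-reflexive βp≡βq)) (β*-cancel-≤ (≤-reflexive (sym βp≡βq)))

  state[-β]≡0 : state (- β) ≡ 0ℚ
  state[-β]≡0 = β*-injective (trans (β*state (- β)) (trans (+-inverseʳ β) (sym (*-zeroʳ β))))

  state[0]≡1 : state 0ℚ ≡ 1ℚ
  state[0]≡1 = β*-injective (trans (β*state 0ℚ) (trans (+-identityʳ β) (sym (*-identityʳ β))))

  Δstep-range : ∀ Δ s → - β ≤ Δstep β H Δ s × Δstep β H Δ s ≤ 0ℚ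
  Δstep-range Δ s = ⊓-glb -β≤0 (p≤q⊔p (Δ + δ H s) (- β)) , p⊓q≤p 0ℚ ((Δ + δ H s) ⊔ (- β))

  chase-move : ∀ Δ s → Move β (g0 H s) (g1 s) (state Δ) (state (Δstep β H Δ s))
  chase-move Δ s with ≤-total (Δ + δ H s) (- β)
  ... | inj₁ Δ+δ≤-β =
    toZero (trans (cong state Δ′≡-β) state[-β]≡0) (lower-clamp {β} {Δ} {δ H s} (β*state Δ) Δ+δ≤-β)
    where
    Δ′≡-β : Δstep β H Δ s ≡ - β
    Δ′≡-β = trans (cong (_⊓_ 0ℚ) (p≤q⇒p⊔q≡q Δ+δ≤-β)) (p≥q⇒p⊓q≡q -β≤0)
  ... | inj₂ -β≤Δ+δ with ≤-total (Δ + δ H s) 0ℚ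
  ...   | inj₁ Δ+δ≤0 =
    interior (interior-shift {β} {Δ} (β*state Δ) (trans (β*state (Δstep β H Δ s)) (cong (_+_ β) Δ′≡Δ+δ)))
    where
    Δ′≡Δ+δ : Δstep β H Δ s ≡ Δ + δ H s
    Δ′≡Δ+δ = trans (cong (_⊓_ 0ℚ) (p≥q⇒p⊔q≡p -β≤Δ+δ)) (p≥q⇒p⊓q≡q Δ+δ≤0)
  ...   | inj₂ 0≤Δ+δ =
    toOne (trans (cong state Δ′≡0) state[0]≡1) (upper-clamp {β} {Δ} {δ H s} (β*state Δ) 0≤Δ+δ)
    where
    Δ′≡0 : Δstep β H Δ s ≡ 0ℚ
    Δ′≡0 = trans (cong (_⊓_ 0ℚ) (p≥q⇒p⊔q≡p (≤-trans -β≤0 0≤Δ+δ))) (p≤q⇒p⊓q≡p 0≤Δ+δ)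

  chase : ∀ {n} → ℚ → Vec Input n → Vec ℚ n
  chase Δ σ = map state (ΔsFrom β H Δ σ)

  chase-competitive : ∀ {n} Δ (σ : Vec Input n) y ys → NonNegInputs H σ → InUnit ys →
    - β ≤ Δ → Δ ≤ 0ℚ → y ∈[0,1] →
    costFrom β H (state Δ) σ (chase Δ σ) ≤ 2ℚ * costFrom β H y σ ys + Φ β (state Δ) y
  chase-competitive Δ [] y [] _ _ -β≤Δ Δ≤0 (0≤y , _) =
    subst (0ℚ ≤_) (sym (+-identityˡ _)) (0≤Φ 0≤β (state-∈[0,1] -β≤Δ Δ≤0) 0≤y)
  chase-competitive Δ (s ∷ σ) y (y′ ∷ ys) (0≤a , 0≤b , σ≥0) (y′∈ ∷ ys∈) -β≤Δ Δ≤0 _ = begin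
    step + rest                                             ≤⟨ +-monoʳ-≤ step (chase-competitive Δ′ σ y′ ys σ≥0 ys∈ -β≤Δ′ Δ′≤0 y′∈) ⟩
    step + (2ℚ * opt + Φ β x′ y′)                           ≡⟨ swap step (2ℚ * opt) (Φ β x′ y′) ⟩
    step + Φ β x′ y′ + 2ℚ * opt                             ≤⟨ +-monoˡ-≤ (2ℚ * opt) amortised ⟩
    2ℚ * (g H s y′ + β * pos (y′ - y)) + Φ β x y + 2ℚ * opt ≡⟨ collect (g H s y′ + β * pos (y′ - y)) (Φ β x y) opt ⟩
    2ℚ * (g H s y′ + β * pos (y′ - y) + opt) + Φ β x y      ∎
    where
    open ≤-Reasoning
    Δ′ x x′ step rest opt : ℚ
    Δ′ = Δstep β H Δ s
    x = state Δ
    x′ = state Δ′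
    step = g H s x′ + β * pos (x′ - x)
    rest = costFrom β H x′ σ (chase Δ′ σ)
    opt = costFrom β H y′ σ ys
    -β≤Δ′ : - β ≤ Δ′
    -β≤Δ′ = proj₁ (Δstep-range Δ s)
    Δ′≤0 : Δ′ ≤ 0ℚ
    Δ′≤0 = proj₂ (Δstep-range Δ s)
    amortised : step + Φ β x′ y′ ≤ 2ℚ * (g H s y′ + β * pos (y′ - y)) + Φ β x y
    amortised = amortised-step y y′ 0≤β 0≤a 0≤b (state-∈[0,1] -β≤Δ Δ≤0) y′∈ (chase-move Δ s)
    swap : ∀ u v w → u + (v + w) ≡ u + w + v
    swap = solve-∀ ℚ-ring
    collect : ∀ u v w → 2ℚ * u + v + 2ℚ * w ≡ 2ℚ * (u + w) + v
    collect = solve-∀ ℚ-ring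

  -- The local helper go of cCHASE cannot be named, so go below is a metavariable: the with
  -- turns all arguments of the helper's call in tail (cCHASE (s ∷ σ)) into distinct variables,
  -- and unification then solves the metavariable with the helper itself.
  mutual
    go : ∀ {n} → Vec Input n → ∀ {m} → Vec ℚ m → Vec ℚ m
    go = _

    cCHASE-tail : ∀ {k} s (σ : Vec Input k) →
      tail (cCHASE β H β>0 (s ∷ σ)) ≡ go (s ∷ σ) (ΔsFrom β H (Δstep β H (- β) s) σ)
    cCHASE-tail {k} s σ with ΔsFrom β H (Δstep β H (- β) s) σ | suc k | s ∷ σ
    ... | _ | _ | _ = refl

  go≗map-state : ∀ {n} (σ : Vec Input n) {m} (Δs : Vec ℚ m) → go σ Δs ≡ map state Δs
  go≗map-state σ []       = refl
  go≗map-state σ (Δ ∷ Δs) = cong (_∷_ (state Δ)) (go≗map-state σ Δs)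

  cCHASE≡chase : ∀ {n} (σ : Vec Input n) → cCHASE β H β>0 σ ≡ chase (- β) σ
  cCHASE≡chase []      = refl
  cCHASE≡chase (s ∷ σ) = cong (_∷_ (state (Δstep β H (- β) s)))
    (trans (cCHASE-tail s σ) (go≗map-state (s ∷ σ) (ΔsFrom β H (Δstep β H (- β) s) σ)))

lemma2 : (β H : ℚ) → (β>0 : β > 0ℚ) →
    Σ ℚ (λ γ → (T : ℕ) → (σ : Vec Input T) → NonNegInputs H σ →
      (x : Vec ℚ T) → InUnit x →
      cost β H σ (cCHASE β H β>0 σ) ≤ (+ 2 / 1) * cost β H σ x + γ)
lemma2 β H β>0 = 0ℚ , λ T σ σ≥0 x x∈ → begin
  cost β H σ (cCHASE β H β>0 σ)                  ≡⟨ cong₂ (λ x₀ xs → costFrom β H x₀ σ xs) (sym state[-β]≡0) (cCHASE≡chase σ) ⟩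
  costFrom β H (state (- β)) σ (chase (- β) σ)   ≤⟨ chase-competitive (- β) σ 0ℚ x σ≥0 x∈ ≤-refl -β≤0 (≤-refl , nonNegative⁻¹ 1ℚ) ⟩
  2ℚ * cost β H σ x + Φ β (state (- β)) 0ℚ       ≡⟨ cong (_+_ (2ℚ * cost β H σ x)) Φ-at-start ⟩
  2ℚ * cost β H σ x + 0ℚ                         ∎
  where
  open Chase β H β>0
  open ≤-Reasoning
  Φ-at-start : Φ β (state (- β)) 0ℚ ≡ 0ℚ
  Φ-at-start = trans (cong (λ x₀ → Φ β x₀ 0ℚ) state[-β]≡0) (Φ-origin β)
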